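{- Let $n,k,s,i$ be positive integers with $n\ge 3.38k$, $\max\{s+2-k,3\}\le i\le \min\{s-1,k\}$ and $s\ge k+1$. Define $$f(n,k,s,i)=\frac{\binom{s-1}{i-1}\binom{n-s}{k-i}+\binom{s-1}{i}\binom{n-s+1}{k-i}}{\binom{s-1}{i-1}\binom{n-s+1}{k-i+1}+\binom{s-1}{i}\binom{n-s+1}{k-i}}.$$ Then $$f(n,k,s,i)>\frac{\binom{n-s}{k-i}}{\binom{n-s}{k-i+1}}.$$
   Context: Binomial coefficients $\binom{a}{b}$ are the usual ones (with $\binom{a}{b}=0$ if $b<0$ or $b>a$). -}

module Defs where

open import Data.Nat using (ℕ; _+_; _*_; _∸_)
open import Data.Nat.Combinatorics using (_C_)

-- f(n,k,s,i) = fNum / fDen   (binomials are ℕ-valued, m C j = 0 for j > m)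
fNum : ℕ → ℕ → ℕ → ℕ → ℕ
fNum n k s i = ((s ∸ 1) C (i ∸ 1)) * ((n ∸ s) C (k ∸ i))
             + ((s ∸ 1) C i) * ((n ∸ s + 1) C (k ∸ i))

fDen : ℕ → ℕ → ℕ → ℕ → ℕ
fDen n k s i = ((s ∸ 1) C (i ∸ 1)) * ((n ∸ s + 1) C (k ∸ i + 1))
             + ((s ∸ 1) C i) * ((n ∸ s + 1) C (k ∸ i))

gNum : ℕ → ℕ → ℕ → ℕ → ℕ
gNum n k s i = (n ∸ s) C (k ∸ i)

gDen : ℕ → ℕ → ℕ → ℕ → ℕ
gDen n k s i = (n ∸ s) C (k ∸ i + 1)

-- Write A = C(s-1,i-1), B = C(s-1,i), c = C(n-s,k-i), d = C(n-s,k-i+1) and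
-- E = C(n-s+1,k-i).  Since C(n-s+1,k-i+1) = c + d, cross-multiplying reduces the
-- claim to A c² < B (d - c) E.  The ratios of neighbouring binomials,
--   t A = i B,   p d = q c,   r E = u c
-- with t = s-i, p = k-i+1, q = n-s-(k-i), r = n-s+1-(k-i), u = n-s+1, turn this
-- (after multiplying by t p r) into  i p r + t p u < t q u,  which holds because
-- p ≤ t (as s ≥ k+1) and q ≥ p + i + 1; the latter needs only n ≥ 3k.

module Submission where

open import Data.List using (_∷_; [])
open import Data.Nat using (ℕ; zero; suc; _+_; _*_; _∸_; _≤_; _<_; z≤n; s≤s; NonZero; >-nonZero)
open import Data.Nat.Combinatorics using (_C_; nC1≡n; nCk+nC[k+1]≡[n+1]C[k+1])
open import Data.Nat.Combinatorics.Specification using (k>n⇒nCk≡0)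
open import Data.Nat.Properties
open import Data.Nat.Tactic.RingSolver using (solve-∀; solve)
open import Data.Product using (_×_; _,_)
open import Relation.Binary.PropositionalEquality
open import Relation.Nullary using (yes; no)

open import Defs

[1+n]C[1+k]≡nCk+nC[1+k] : ∀ n k → suc n C suc k ≡ n C k + n C suc k
[1+n]C[1+k]≡nCk+nC[1+k] n k = sym (nCk+nC[k+1]≡[n+1]C[k+1] n k)

0<nCk : ∀ {n k} → k ≤ n → 0 < n C k
0<nCk {n}     {zero}  _         = s≤s z≤n
0<nCk {suc n} {suc k} (s≤s k≤n) =
  subst (0 <_) (sym ([1+n]C[1+k]≡nCk+nC[1+k] n k)) (≤-trans (0<nCk k≤n) (m≤m+n _ _))

[1+k]*[1+n]C[1+k]≡[1+n]*nCk : ∀ n k → suc k * (suc n C suc k) ≡ suc n * (n C k)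
[1+k]*[1+n]C[1+k]≡[1+n]*nCk zero    zero    = refl
[1+k]*[1+n]C[1+k]≡[1+n]*nCk zero    (suc k) = *-zeroʳ (2 + k)
[1+k]*[1+n]C[1+k]≡[1+n]*nCk (suc n) zero    =
  trans (+-identityʳ _) (trans (nC1≡n (2 + n)) (sym (*-identityʳ (2 + n))))
[1+k]*[1+n]C[1+k]≡[1+n]*nCk (suc n) (suc k) = begin
  (2 + k) * ((2 + n) C (2 + k))         ≡⟨ cong ((2 + k) *_) ([1+n]C[1+k]≡nCk+nC[1+k] (suc n) (suc k)) ⟩
  (2 + k) * (a + b)                     ≡⟨ split k a b ⟩
  a + ((1 + k) * a + (2 + k) * b)       ≡⟨ cong₂ (λ u v → a + (u + v)) ih₁ ih₂ ⟩
  a + ((1 + n) * x + (1 + n) * y)       ≡⟨ cong (_+ ((1 + n) * x + (1 + n) * y)) pascal-a ⟩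
  (x + y) + ((1 + n) * x + (1 + n) * y) ≡⟨ merge n x y ⟩
  (2 + n) * (x + y)                     ≡⟨ cong ((2 + n) *_) pascal-a ⟨
  (2 + n) * a                           ∎
  where
  open ≡-Reasoning
  a = suc n C suc k
  b = suc n C (2 + k)
  x = n C k
  y = n C suc k
  pascal-a : a ≡ x + y
  pascal-a = [1+n]C[1+k]≡nCk+nC[1+k] n k
  ih₁ : (1 + k) * a ≡ (1 + n) * x
  ih₁ = [1+k]*[1+n]C[1+k]≡[1+n]*nCk n k
  ih₂ : (2 + k) * b ≡ (1 + n) * y
  ih₂ = [1+k]*[1+n]C[1+k]≡[1+n]*nCk n (suc k)
  split : ∀ k x y → (2 + k) * (x + y) ≡ x + ((1 + k) * x + (2 + k) * y)
  split = solve-∀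
  merge : ∀ n x y → (x + y) + ((1 + n) * x + (1 + n) * y) ≡ (2 + n) * (x + y)
  merge = solve-∀

[1+k]*nC[1+k]≡[n∸k]*nCk : ∀ n k → suc k * (n C suc k) ≡ (n ∸ k) * (n C k)
[1+k]*nC[1+k]≡[n∸k]*nCk n k with k ≤? n
... | no k≰n = begin
  suc k * (n C suc k) ≡⟨ cong (suc k *_) (k>n⇒nCk≡0 (m≤n⇒m≤1+n (≰⇒> k≰n))) ⟩
  suc k * 0           ≡⟨ *-zeroʳ (suc k) ⟩
  0                   ≡⟨ cong (_* (n C k)) (m≤n⇒m∸n≡0 (<⇒≤ (≰⇒> k≰n))) ⟨
  (n ∸ k) * (n C k)   ∎
  where open ≡-Reasoning
... | yes k≤n = +-cancelʳ-≡ (suc k * (n C k)) _ _ (begin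
  suc k * (n C suc k) + suc k * (n C k) ≡⟨ +-comm _ (suc k * (n C k)) ⟩
  suc k * (n C k) + suc k * (n C suc k) ≡⟨ *-distribˡ-+ (suc k) (n C k) (n C suc k) ⟨
  suc k * (n C k + n C suc k)           ≡⟨ cong (suc k *_) ([1+n]C[1+k]≡nCk+nC[1+k] n k) ⟨
  suc k * (suc n C suc k)               ≡⟨ [1+k]*[1+n]C[1+k]≡[1+n]*nCk n k ⟩
  suc n * (n C k)                       ≡⟨ cong (_* (n C k)) (m∸n+n≡m (s≤s k≤n)) ⟨
  (n ∸ k + suc k) * (n C k)             ≡⟨ *-distribʳ-+ (n C k) (n ∸ k) (suc k) ⟩
  (n ∸ k) * (n C k) + suc k * (n C k)   ∎)
  where open ≡-Reasoning

[1+n∸k]*[1+n]Ck≡[1+n]*nCk : ∀ n k → (suc n ∸ k) * (suc n C k) ≡ suc n * (n C k)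
[1+n∸k]*[1+n]Ck≡[1+n]*nCk n k =
  trans (sym ([1+k]*nC[1+k]≡[n∸k]*nCk (suc n) k)) ([1+k]*[1+n]C[1+k]≡[1+n]*nCk n k)

cross-multiplied-bound : ∀ {A B c d E t i p q r u} →
  t * A ≡ i * B → p * d ≡ q * c → r * E ≡ u * c → 0 < B → 0 < c →
  i * p * r + t * p * u < t * q * u →
  c * (A * (c + d) + B * E) < (A * c + B * E) * d
cross-multiplied-bound {A} {B} {c} {d} {E} {t} {i} {p} {q} {r} {u} tA≡iB pd≡qc rE≡uc 0<B 0<c ineq =
  *-cancelˡ-< (t * p * r) _ _ (subst₂ _<_ (sym scaled-lhs) (sym scaled-rhs)
    (*-monoʳ-< (B * c * c) (+-monoʳ-< (i * r * q) ineq)))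
  where
  open ≡-Reasoning
  instance
    Bc²≢0 : NonZero (B * c * c)
    Bc²≢0 = >-nonZero (*-mono-< (*-mono-< 0<B 0<c) 0<c)
  scaled-lhs : t * p * r * (c * (A * (c + d) + B * E)) ≡ B * c * c * (i * r * q + (i * p * r + t * p * u))
  scaled-lhs = begin
    t * p * r * (c * (A * (c + d) + B * E))
      ≡⟨ solve (t ∷ p ∷ r ∷ c ∷ A ∷ B ∷ d ∷ E ∷ []) ⟩
    (t * A) * (p * r * c * c) + (t * A) * (r * c) * (p * d) + t * p * B * c * (r * E)
      ≡⟨ cong₂ (λ x y → x * (p * r * c * c) + x * (r * c) * y + t * p * B * c * (r * E)) tA≡iB pd≡qc ⟩
    (i * B) * (p * r * c * c) + (i * B) * (r * c) * (q * c) + t * p * B * c * (r * E)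
      ≡⟨ cong (λ z → (i * B) * (p * r * c * c) + (i * B) * (r * c) * (q * c) + t * p * B * c * z) rE≡uc ⟩
    (i * B) * (p * r * c * c) + (i * B) * (r * c) * (q * c) + t * p * B * c * (u * c)
      ≡⟨ solve (t ∷ i ∷ p ∷ q ∷ r ∷ u ∷ c ∷ B ∷ []) ⟩
    B * c * c * (i * r * q + (i * p * r + t * p * u)) ∎
  scaled-rhs : t * p * r * ((A * c + B * E) * d) ≡ B * c * c * (i * r * q + t * q * u)
  scaled-rhs = begin
    t * p * r * ((A * c + B * E) * d)
      ≡⟨ solve (t ∷ p ∷ r ∷ c ∷ A ∷ B ∷ d ∷ E ∷ []) ⟩
    (t * A) * (r * c) * (p * d) + t * B * (r * E) * (p * d)
      ≡⟨ cong₂ (λ x y → x * (r * c) * y + t * B * (r * E) * y) tA≡iB pd≡qc ⟩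
    (i * B) * (r * c) * (q * c) + t * B * (r * E) * (q * c)
      ≡⟨ cong (λ z → (i * B) * (r * c) * (q * c) + t * B * z * (q * c)) rE≡uc ⟩
    (i * B) * (r * c) * (q * c) + t * B * (u * c) * (q * c)
      ≡⟨ solve (t ∷ i ∷ q ∷ r ∷ u ∷ c ∷ B ∷ []) ⟩
    B * c * c * (i * r * q + t * q * u) ∎

i*p*r+t*p*u<t*q*u : ∀ {i p q r t u} → p ≤ t → r ≤ u → 0 < p → 0 < u → p + suc i ≤ q →
  i * p * r + t * p * u < t * q * u
i*p*r+t*p*u<t*q*u {i} {p} {q} {r} {t} {u} p≤t r≤u 0<p 0<u p+1+i≤q = begin-strict
  i * p * r + t * p * u         ≤⟨ +-monoˡ-≤ (t * p * u) (*-mono-≤ (*-monoʳ-≤ i p≤t) r≤u) ⟩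
  i * t * u + t * p * u         <⟨ +-monoˡ-< (t * p * u) (m<n+m (i * t * u) (*-mono-< 0<t 0<u)) ⟩
  t * u + i * t * u + t * p * u ≡⟨ solve (i ∷ p ∷ t ∷ u ∷ []) ⟩
  t * (p + suc i) * u           ≤⟨ *-monoˡ-≤ u (*-monoʳ-≤ t p+1+i≤q) ⟩
  t * q * u                     ∎
  where
  open ≤-Reasoning
  0<t : 0 < t
  0<t = ≤-trans 0<p p≤t

-- Here s, i, m, j play the roles of s-1, i-1, n-s and k-i.
binomial-ratio-bound : ∀ s i m j → suc i ≤ s → suc j ≤ s ∸ i → suc j + suc (suc i) + j ≤ m →
  let A = s C i ; B = s C suc i ; c = m C j ; d = m C suc j ; F = suc m C suc j ; E = suc m C j in
  0 < A * F + B * E × 0 < d × c * (A * F + B * E) < (A * c + B * E) * d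
binomial-ratio-bound s i m j i<s j<s∸i m≥2j+i+3 =
  ≤-trans (*-mono-< (0<nCk i<s) (0<nCk (m≤n⇒m≤1+n j≤m))) (m≤n+m _ _) ,
  0<nCk j<m ,
  subst (λ F → c * (A * F + B * E) < (A * c + B * E) * d) (sym ([1+n]C[1+k]≡nCk+nC[1+k] m j))
    (cross-multiplied-bound {A} {B} {c} {d} {E} {t} {suc i} {suc j} {m ∸ j} {suc m ∸ j} {suc m}
      (sym ([1+k]*nC[1+k]≡[n∸k]*nCk s i))
      ([1+k]*nC[1+k]≡[n∸k]*nCk m j)
      ([1+n∸k]*[1+n]Ck≡[1+n]*nCk m j)
      (0<nCk i<s) (0<nCk j≤m)
      (i*p*r+t*p*u<t*q*u j<s∸i (m∸n≤m (suc m) j) (s≤s z≤n) (s≤s z≤n) (m+n≤o⇒m≤o∸n _ m≥2j+i+3)))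
  where
  A = s C i
  B = s C suc i
  c = m C j
  d = m C suc j
  E = suc m C j
  t = s ∸ i
  j<m : suc j ≤ m
  j<m = ≤-trans (m≤m+n (suc j) _) (≤-trans (m≤m+n _ j) m≥2j+i+3)
  j≤m : j ≤ m
  j≤m = <⇒≤ j<m

1+j+1+i+j≤n∸s : ∀ {n s i j} → s + 2 ≤ (i + j) + i → 338 * (i + j) ≤ 100 * n → suc j + suc i + j ≤ n ∸ s
1+j+1+i+j≤n∸s {n} {s} {i} {j} s+2≤k+i 338k≤100n = m+n≤o⇒m≤o∸n _ (*-cancelˡ-≤ 100 (begin
  100 * (suc j + suc i + j + s)          ≡⟨ solve (s ∷ i ∷ j ∷ []) ⟩
  100 * (s + 2) + 100 * (i + j + j)      ≤⟨ +-monoˡ-≤ (100 * (i + j + j)) (*-monoʳ-≤ 100 s+2≤k+i) ⟩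
  100 * ((i + j) + i) + 100 * (i + j + j) ≡⟨ solve (i ∷ j ∷ []) ⟩
  300 * (i + j)                          ≤⟨ *-monoˡ-≤ (i + j) (m≤m+n 300 38) ⟩
  338 * (i + j)                          ≤⟨ 338k≤100n ⟩
  100 * n                                ∎))
  where open ≤-Reasoning

lemma3p1 : (n k s i : ℕ) → 1 ≤ n → 1 ≤ k → 1 ≤ s → 1 ≤ i →
             338 * k ≤ 100 * n →
             s + 2 ∸ k ≤ i → 3 ≤ i → i ≤ s ∸ 1 → i ≤ k →
             k + 1 ≤ s →
             (0 < fDen n k s i × 0 < gDen n k s i ×
              gNum n k s i * fDen n k s i < fNum n k s i * gDen n k s i)
-- Matching on refl replaces k by (1 + i) + j.
lemma3p1 n k (suc s) (suc i) _ _ _ _ 338k≤100n s+2∸k≤i _ i<s i≤k k<s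
  with k ∸ suc i | m+[n∸m]≡n i≤k
... | j | refl
  rewrite +-comm (n ∸ suc s) 1 | +-comm j 1 =
  binomial-ratio-bound s i (n ∸ suc s) j i<s j<s∸i (1+j+1+i+j≤n∸s {n} {suc s} {suc i} {j} s+2≤k+i 338k≤100n)
  where
  s+2≤k+i : suc s + 2 ≤ (suc i + j) + suc i
  s+2≤k+i = ≤-trans (m≤n+m∸n (suc s + 2) (suc i + j)) (+-monoʳ-≤ (suc i + j) s+2∸k≤i)
  k+1≡2+j+i : suc i + j + 1 ≡ suc (suc j + i)
  k+1≡2+j+i = solve (i ∷ j ∷ [])
  j<s∸i : suc j ≤ s ∸ i
  j<s∸i = m+n≤o⇒m≤o∸n (suc j) (≤-pred (subst (_≤ suc s) k+1≡2+j+i k<s))
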